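{- Let $n\geq 4$, let $C=\operatorname{circ}(1,0,\ldots,0,-1)$ be the circulant matrix of order $n-1$, and let $X=(CC^T+I_{n-1})^{ -1}(J_{n-1}-nI_{n-1})$. Then $X=\operatorname{circ}(b_0,b_1,\ldots,b_{n-2})$, where for $j=0,1,\ldots,n-2$, \[b_j=1+\frac{n2^{n-1-j}}{\sqrt{5}}\left[\frac{(3+\sqrt{5})^j}{2^{n-1}-(3+\sqrt{5})^{n-1}}-\frac{(3-\sqrt{5})^j}{2^{n-1}-(3-\sqrt{5})^{n-1}}\right].\]
   Context: For real numbers $c_0,\ldots,c_{k-1}$, $\operatorname{circ}(c_0,c_1,\ldots,c_{k-1})$ denotes the $k\times k$ circulant matrix whose $(i,j)$-entry is $c_{(j-i)\bmod k}$. $I_k$ is the $k\times k$ identity matrix and $J_k$ the $k\times k$ all-ones matrix. -}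

module Defs where

open import Data.Nat as ℕ using (ℕ; zero; suc)
open import Data.Nat.DivMod using (_mod_)
open import Data.Fin using (Fin; toℕ)
open import Data.Rational as ℚ using (ℚ; 0ℚ; 1ℚ)
open import Data.Integer using (+_; -[1+_])
open import Relation.Nullary using (yes; no)
open import Relation.Binary.PropositionalEquality using (_≡_)

-- Total inverse on ℚ (inverse of 0 is 0; only used on nonzero values)

invℚ : ℚ → ℚ
invℚ q with q ℚ.≟ 0ℚ
... | yes _ = 0ℚ
... | no q≢0 = ℚ.1/_ q {{ℚ.≢-nonZero q≢0}}

-- The real subfield ℚ(√5) ⊂ ℝ : elements re + im·√5 with re, im ∈ ℚ.
-- Since √5 is irrational this representation is unique, so ≡ is equality
-- of real numbers.

record Q5 : Set where
  constructor _+√5·_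
  field
    re : ℚ
    im : ℚ
open Q5 public

fromℚ : ℚ → Q5
fromℚ q = q +√5· 0ℚ

fromℕ : ℕ → Q5
fromℕ n = fromℚ (ℚ.mkℚ (+ n) 0 (Data.Nat.Coprimality.sym (Data.Nat.Coprimality.1-coprimeTo n)))
  where import Data.Nat.Coprimality

0q 1q √5 : Q5
0q = fromℚ 0ℚ
1q = fromℚ 1ℚ
√5 = 0ℚ +√5· 1ℚ

infixl 6 _+q_ _-q_
infixl 7 _*q_ _/q_

_+q_ : Q5 → Q5 → Q5
(a +√5· b) +q (c +√5· d) = (a ℚ.+ c) +√5· (b ℚ.+ d)

-q_ : Q5 → Q5
-q (a +√5· b) = (ℚ.- a) +√5· (ℚ.- b)

_-q_ : Q5 → Q5 → Q5
x -q y = x +q (-q y)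

_*q_ : Q5 → Q5 → Q5
(a +√5· b) *q (c +√5· d) =
  (a ℚ.* c ℚ.+ fromℕℚ 5 ℚ.* b ℚ.* d) +√5· (a ℚ.* d ℚ.+ b ℚ.* c)
  where fromℕℚ : ℕ → ℚ
        fromℕℚ n = re (fromℕ n)

-- multiplicative inverse (total; 1/0 := 0): (a + b√5)⁻¹ = (a − b√5)/(a² − 5b²)
invq : Q5 → Q5
invq (a +√5· b) = (a ℚ.* N⁻¹) +√5· (ℚ.- b ℚ.* N⁻¹)
  where N⁻¹ = invℚ (a ℚ.* a ℚ.- re (fromℕ 5) ℚ.* b ℚ.* b)

_/q_ : Q5 → Q5 → Q5
x /q y = x *q invq y

_^q_ : Q5 → ℕ → Q5
x ^q zero = 1q
x ^q suc m = x *q (x ^q m)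

Mat : ℕ → Set
Mat k = Fin k → Fin k → Q5

Σq : (k : ℕ) → (Fin k → Q5) → Q5
Σq zero f = 0q
Σq (suc k) f = f Fin.zero +q Σq k (λ i → f (Fin.suc i))
  where import Data.Fin as Fin

_⊗_ : {k : ℕ} → Mat k → Mat k → Mat k
_⊗_ {k} A B i j = Σq k (λ l → A i l *q B l j)

_⊕_ : {k : ℕ} → Mat k → Mat k → Mat k
(A ⊕ B) i j = A i j +q B i j

_⊖_ : {k : ℕ} → Mat k → Mat k → Mat k
(A ⊖ B) i j = A i j -q B i j

_·M_ : {k : ℕ} → Q5 → Mat k → Mat k
(c ·M A) i j = c *q A i j

transpose : {k : ℕ} → Mat k → Mat k
transpose A i j = A j i

Iₘ : (k : ℕ) → Mat k
Iₘ k i j with toℕ i ℕ.≟ toℕ j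
... | yes _ = 1q
... | no _ = 0q

Jₘ : (k : ℕ) → Mat k
Jₘ k i j = 1q

_≐_ : {k : ℕ} → Mat k → Mat k → Set
A ≐ B = ∀ i j → A i j ≡ B i j

-- circ(c₀,…,c_{k-1}) : (i,j)-entry is c_{(j−i) mod k}
circ : (k : ℕ) → (Fin k → Q5) → Mat k
circ zero c ()
circ (suc k) c i j = c ((toℕ j ℕ.+ (suc k ℕ.∸ toℕ i)) mod suc k)

cC : (k : ℕ) → Fin k → Q5
cC k j with toℕ j ℕ.≟ 0
... | yes _ = 1q
... | no _ with toℕ j ℕ.≟ k ℕ.∸ 1
...   | yes _ = -q 1q
...   | no _ = 0q

Cₘ : (n : ℕ) → Mat (n ℕ.∸ 1)
Cₘ n = circ (n ℕ.∸ 1) (cC (n ℕ.∸ 1))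

Mₘ : (n : ℕ) → Mat (n ℕ.∸ 1)
Mₘ n = (Cₘ n ⊗ transpose (Cₘ n)) ⊕ Iₘ (n ℕ.∸ 1)

Rₘ : (n : ℕ) → Mat (n ℕ.∸ 1)
Rₘ n = Jₘ (n ℕ.∸ 1) ⊖ (fromℕ n ·M Iₘ (n ℕ.∸ 1))

three : Q5
three = fromℕ 3

bcoef : (n : ℕ) → Fin (n ℕ.∸ 1) → Q5
bcoef n j =
  1q +q ((fromℕ n *q (fromℕ 2 ^q (n ℕ.∸ 1 ℕ.∸ toℕ j))) /q √5) *q
        ( ((three +q √5) ^q toℕ j) /q ((fromℕ 2 ^q (n ℕ.∸ 1)) -q ((three +q √5) ^q (n ℕ.∸ 1)))
       -q ((three -q √5) ^q toℕ j) /q ((fromℕ 2 ^q (n ℕ.∸ 1)) -q ((three -q √5) ^q (n ℕ.∸ 1))) )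

{-# OPTIONS --safe #-}
-- Multiplying a circulant matrix on either side by M = C Cᵀ + I, which has 3 on the diagonal
-- and −1 on the two cyclic off-diagonals, gives the circulant matrix of the cyclic second
-- difference Δc_d = 3 c_d − c_{d−1} − c_{d+1}. The numbers b_j satisfy Δb_d = 1 − n δ_{d0}: at
-- interior indices because (3 ± √5)/2 are the roots of x² − 3x + 1, and at the two
-- wrap-around indices because of the choice of the denominators 2^{n−1} − (3 ± √5)^{n−1}.
-- Hence M circ(b) = J − n I, circ((1 − b)/n) is a two-sided inverse of M, and any left
-- inverse X of M satisfies X (J − n I) = X M circ(b) = circ(b). The computation takes place
-- in ℚ(√5), which is a field because √5 is irrational.
module Submission where

open import Defs
open import Data.Nat as ℕ using (ℕ; zero; suc; _+_; _*_; _∸_; _%_; _<_; _≤_; z≤n; s≤s)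
import Data.Nat.Properties as ℕP
open import Data.Nat.Divisibility using (_∣_; divides)
open import Data.Nat.DivMod using (_mod_; m<n⇒m%n≡m; %-distribˡ-+; m%n%n≡m%n; [m+n]%n≡m%n)
open import Data.Nat.Primality using (Prime; prime?; euclidsLemma; prime⇒nonZero)
open import Data.Nat.Induction using (<-wellFounded)
open import Data.Nat.Tactic.RingSolver using (solve-∀)
import Data.Nat.Solver as ℕ-Solver
open import Data.Integer as ℤ using (+_)
import Data.Integer.Properties as ℤP
open import Data.Rational as ℚ using (ℚ; 0ℚ; 1ℚ)
import Data.Rational.Properties as ℚP
import Data.Rational.Unnormalised as ℚᵘ
import Data.Rational.Unnormalised.Properties as ℚᵘP
import Data.Rational.Solver as ℚ-Solver
open import Data.Fin as Fin using (Fin; zero; suc; toℕ)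
import Data.Fin.Properties as FinP
open import Data.Product using (Σ; _×_; _,_; proj₁; proj₂)
open import Data.Sum using (_⊎_; inj₁; inj₂; reduce)
open import Function using (_∘_)
open import Induction.WellFounded using (Acc; acc)
open import Relation.Nullary using (yes; no; contradiction)
open import Relation.Nullary.Decidable using (toWitness)
open import Relation.Binary.Definitions using (DecidableEquality)
open import Relation.Binary.PropositionalEquality hiding ([_])
open import Algebra.Bundles using (CommutativeRing)
open import Algebra.Structures {A = Q5} _≡_ using (IsCommutativeRing)
import Algebra.Properties.Group as GroupProperties
import Algebra.Properties.Ring as RingProperties
import Algebra.Properties.Semiring.Sum as SemiringSum
import Algebra.Solver.Ring.Simple as SimpleRingSolver
import Algebra.Solver.Ring.AlmostCommutativeRing as ACR

-- Irrationality of √p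

prime∣x*x⇒prime∣x : ∀ {p x} → Prime p → p ∣ x * x → p ∣ x
prime∣x*x⇒prime∣x {x = x} pp p∣x*x = reduce (euclidsLemma x x pp p∣x*x)

[m*n]*[m*n]≡n*[n*[m*m]] : ∀ m n → (m * n) * (m * n) ≡ n * (n * (m * m))
[m*n]*[m*n]≡n*[n*[m*m]] = solve-∀

x*x≡p*[y*y]⇒y≡0 : ∀ {p} → Prime p → ∀ x y → x * x ≡ p * (y * y) → y ≡ 0
x*x≡p*[y*y]⇒y≡0 {p} pp x y = descent (<-wellFounded y) x
  where
  instance _ = prime⇒nonZero pp

  -- Writing x = q p and then y = r p turns x * x ≡ p * (y * y) into q * q ≡ p * (r * r), r < y.
  descent : ∀ {y} → Acc _<_ y → ∀ x → x * x ≡ p * (y * y) → y ≡ 0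
  descent-cofactor : ∀ {y} → Acc _<_ y → ∀ q → p * (q * q) ≡ y * y → y ≡ 0

  descent {y} acc-y x x*x≡p*y*y
    with prime∣x*x⇒prime∣x {x = x} pp (divides (y * y) (trans x*x≡p*y*y (ℕP.*-comm p _)))
  ... | divides q refl =
    descent-cofactor acc-y q (ℕP.*-cancelˡ-≡ _ _ p (trans (sym ([m*n]*[m*n]≡n*[n*[m*m]] q p)) x*x≡p*y*y))

  descent-cofactor {y} (acc rec) q p*q*q≡y*y
    with prime∣x*x⇒prime∣x {x = y} pp (divides (q * q) (trans (sym p*q*q≡y*y) (ℕP.*-comm p _)))
  ... | divides zero y≡0 = y≡0
  ... | divides r@(suc _) y≡r*p = trans y≡r*p (cong (_* p) (descent (rec r<y) q q*q≡p*r*r))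
    where
    r<y : r < y
    r<y = subst (r <_) (sym y≡r*p) (ℕP.m<m*n r p (ℕ.nonTrivial⇒n>1 p))
    q*q≡p*r*r : q * q ≡ p * (r * r)
    q*q≡p*r*r = ℕP.*-cancelˡ-≡ _ _ p
      (trans p*q*q≡y*y (trans (cong (λ z → z * z) y≡r*p) ([m*n]*[m*n]≡n*[n*[m*m]] r p)))

√prime∉ℚ : ∀ {p} → Prime p → ∀ a b → a ℚ.* a ≡ re (fromℕ p) ℚ.* b ℚ.* b → b ≡ 0ℚ
√prime∉ℚ {p} pp a@record{} b@record{} a*a≡p*b*b =
  ℚP.↥p≡0⇒p≡0 b (ℤP.∣i∣≡0⇒i≡0 (ℕP.m*n≡0⇒m≡0 B Da
    (x*x≡p*[y*y]⇒y≡0 pp (A * Db) (B * Da) cleared)))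
  where
  open ≡-Reasoning
  A B Da Db : ℕ
  A = ℤ.∣ ℚ.↥ a ∣
  B = ℤ.∣ ℚ.↥ b ∣
  Da = ℚ.↧ₙ a
  Db = ℚ.↧ₙ b

  in-ℚᵘ : ℚ.toℚᵘ a ℚᵘ.* ℚ.toℚᵘ a ℚᵘ.≃ (ℚ.toℚᵘ (re (fromℕ p)) ℚᵘ.* ℚ.toℚᵘ b) ℚᵘ.* ℚ.toℚᵘ b
  in-ℚᵘ = ℚᵘP.≃-trans (ℚᵘP.≃-sym (ℚP.toℚᵘ-homo-* a a))
    (ℚᵘP.≃-trans (ℚᵘP.≃-reflexive (cong ℚ.toℚᵘ a*a≡p*b*b))
    (ℚᵘP.≃-trans (ℚP.toℚᵘ-homo-* (re (fromℕ p) ℚ.* b) b)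
                 (ℚᵘP.*-congʳ (ℚP.toℚᵘ-homo-* (re (fromℕ p)) b))))

  regroupˡ : ∀ m n → (m * n) * (m * n) ≡ (m * m) * ((1 * n) * n)
  regroupˡ = solve-∀
  regroupʳ : ∀ m n o → (m * n * n) * (o * o) ≡ m * ((n * o) * (n * o))
  regroupʳ = solve-∀

  cleared : (A * Db) * (A * Db) ≡ p * ((B * Da) * (B * Da))
  cleared = begin
    (A * Db) * (A * Db)
      ≡⟨ regroupˡ A Db ⟩
    (A * A) * ((1 * Db) * Db)
      ≡⟨ cong (_* _) (ℤP.abs-* (ℚ.↥ a) (ℚ.↥ a)) ⟨
    ℤ.∣ ℚ.↥ a ℤ.* ℚ.↥ a ∣ * ((1 * Db) * Db)
      ≡⟨ ℤP.abs-* (ℚ.↥ a ℤ.* ℚ.↥ a) _ ⟨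
    ℤ.∣ (ℚ.↥ a ℤ.* ℚ.↥ a) ℤ.* + ((1 * Db) * Db) ∣
      ≡⟨ cong ℤ.∣_∣ (ℚᵘP.drop-*≡* in-ℚᵘ) ⟩
    ℤ.∣ ((+ p ℤ.* ℚ.↥ b) ℤ.* ℚ.↥ b) ℤ.* + (Da * Da) ∣
      ≡⟨ ℤP.abs-* ((+ p ℤ.* ℚ.↥ b) ℤ.* ℚ.↥ b) _ ⟩
    ℤ.∣ (+ p ℤ.* ℚ.↥ b) ℤ.* ℚ.↥ b ∣ * (Da * Da)
      ≡⟨ cong (_* (Da * Da)) (trans (ℤP.abs-* (+ p ℤ.* ℚ.↥ b) (ℚ.↥ b)) (cong (_* B) (ℤP.abs-* (+ p) (ℚ.↥ b)))) ⟩
    (p * B * B) * (Da * Da)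
      ≡⟨ regroupʳ p B Da ⟩
    p * ((B * Da) * (B * Da)) ∎

-- The field ℚ(√5)

5ℚ : ℚ
5ℚ = re (fromℕ 5)

+√5·-cong : ∀ {a b c d} → a ≡ c → b ≡ d → (a +√5· b) ≡ (c +√5· d)
+√5·-cong = cong₂ _+√5·_

module _ where
  open ℚ-Solver.+-*-Solver

  +q-assoc : ∀ x y z → (x +q y) +q z ≡ x +q (y +q z)
  +q-assoc (a +√5· b) (c +√5· d) (e +√5· f) = +√5·-cong (ℚP.+-assoc a c e) (ℚP.+-assoc b d f)

  +q-comm : ∀ x y → x +q y ≡ y +q x
  +q-comm (a +√5· b) (c +√5· d) = +√5·-cong (ℚP.+-comm a c) (ℚP.+-comm b d)

  +q-identityˡ : ∀ x → 0q +q x ≡ x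
  +q-identityˡ (a +√5· b) = +√5·-cong (ℚP.+-identityˡ a) (ℚP.+-identityˡ b)

  +q-identityʳ : ∀ x → x +q 0q ≡ x
  +q-identityʳ (a +√5· b) = +√5·-cong (ℚP.+-identityʳ a) (ℚP.+-identityʳ b)

  -q-inverseˡ : ∀ x → (-q x) +q x ≡ 0q
  -q-inverseˡ (a +√5· b) = +√5·-cong (ℚP.+-inverseˡ a) (ℚP.+-inverseˡ b)

  -q-inverseʳ : ∀ x → x +q (-q x) ≡ 0q
  -q-inverseʳ (a +√5· b) = +√5·-cong (ℚP.+-inverseʳ a) (ℚP.+-inverseʳ b)

  *q-comm : ∀ x y → x *q y ≡ y *q x
  *q-comm (a +√5· b) (c +√5· d) = +√5·-cong
    (solve 5 (λ a b c d f → a :* c :+ f :* b :* d := c :* a :+ f :* d :* b) refl a b c d 5ℚ)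
    (solve 4 (λ a b c d → a :* d :+ b :* c := c :* b :+ d :* a) refl a b c d)

  *q-assoc : ∀ x y z → (x *q y) *q z ≡ x *q (y *q z)
  *q-assoc (a +√5· b) (c +√5· d) (e +√5· g) = +√5·-cong
    (solve 7 (λ a b c d e g f → (a :* c :+ f :* b :* d) :* e :+ f :* (a :* d :+ b :* c) :* g
              := a :* (c :* e :+ f :* d :* g) :+ f :* b :* (c :* g :+ d :* e)) refl a b c d e g 5ℚ)
    (solve 7 (λ a b c d e g f → (a :* c :+ f :* b :* d) :* g :+ (a :* d :+ b :* c) :* e
              := a :* (c :* g :+ d :* e) :+ b :* (c :* e :+ f :* d :* g)) refl a b c d e g 5ℚ)

  *q-identityˡ : ∀ x → 1q *q x ≡ x
  *q-identityˡ (a +√5· b) = +√5·-cong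
    (solve 2 (λ a b → con 1ℚ :* a :+ con 5ℚ :* con 0ℚ :* b := a) refl a b)
    (solve 2 (λ a b → con 1ℚ :* b :+ con 0ℚ :* a := b) refl a b)

  *q-identityʳ : ∀ x → x *q 1q ≡ x
  *q-identityʳ x = trans (*q-comm x 1q) (*q-identityˡ x)

  *q-distribˡ-+q : ∀ x y z → x *q (y +q z) ≡ (x *q y) +q (x *q z)
  *q-distribˡ-+q (a +√5· b) (c +√5· d) (e +√5· g) = +√5·-cong
    (solve 7 (λ a b c d e g f → a :* (c :+ e) :+ f :* b :* (d :+ g)
       := (a :* c :+ f :* b :* d) :+ (a :* e :+ f :* b :* g)) refl a b c d e g 5ℚ)
    (solve 6 (λ a b c d e g → a :* (d :+ g) :+ b :* (c :+ e)
       := (a :* d :+ b :* c) :+ (a :* g :+ b :* e)) refl a b c d e g)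

  *q-distribʳ-+q : ∀ x y z → (y +q z) *q x ≡ (y *q x) +q (z *q x)
  *q-distribʳ-+q x y z = trans (*q-comm (y +q z) x)
    (trans (*q-distribˡ-+q x y z) (cong₂ _+q_ (*q-comm x y) (*q-comm x z)))

Q5-isCommutativeRing : IsCommutativeRing _+q_ _*q_ -q_ 0q 1q
Q5-isCommutativeRing = record
  { isRing = record
    { +-isAbelianGroup = record
      { isGroup = record
        { isMonoid = record
          { isSemigroup = record
            { isMagma = record { isEquivalence = isEquivalence ; ∙-cong = cong₂ _+q_ }
            ; assoc = +q-assoc }
          ; identity = +q-identityˡ , +q-identityʳ }
        ; inverse = -q-inverseˡ , -q-inverseʳ
        ; ⁻¹-cong = cong (λ x → -q x) }
      ; comm = +q-comm }
    ; *-cong = cong₂ _*q_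
    ; *-assoc = *q-assoc
    ; *-identity = *q-identityˡ , *q-identityʳ
    ; distrib = *q-distribˡ-+q , *q-distribʳ-+q }
  ; *-comm = *q-comm }

Q5-commutativeRing : CommutativeRing _ _
Q5-commutativeRing = record { isCommutativeRing = Q5-isCommutativeRing }

_≟q_ : DecidableEquality Q5
(a +√5· b) ≟q (c +√5· d) with a ℚ.≟ c | b ℚ.≟ d
... | yes refl | yes refl = yes refl
... | no a≢c | _ = no (a≢c ∘ cong re)
... | _ | no b≢d = no (b≢d ∘ cong im)

module Q5-Solver = SimpleRingSolver (ACR.fromCommutativeRing Q5-commutativeRing) _≟q_

x-q-y≡0q⇒x≡y : ∀ x y → x -q y ≡ 0q → x ≡ y
x-q-y≡0q⇒x≡y = GroupProperties.x∙y⁻¹≈ε⇒x≈y (CommutativeRing.+-group Q5-commutativeRing)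

norm : Q5 → ℚ
norm (a +√5· b) = a ℚ.* a ℚ.- 5ℚ ℚ.* b ℚ.* b

a*a≡0⇒a≡0 : ∀ a → a ℚ.* a ≡ 0ℚ → a ≡ 0ℚ
a*a≡0⇒a≡0 a a*a≡0 with a ℚ.≟ 0ℚ
... | yes a≡0 = a≡0
... | no a≢0 = begin
  a                      ≡⟨ ℚP.*-identityʳ a ⟨
  a ℚ.* 1ℚ               ≡⟨ cong (a ℚ.*_) (ℚP.*-inverseʳ a) ⟨
  a ℚ.* (a ℚ.* ℚ.1/ a)   ≡⟨ ℚP.*-assoc a a _ ⟨
  (a ℚ.* a) ℚ.* ℚ.1/ a   ≡⟨ cong (ℚ._* ℚ.1/ a) a*a≡0 ⟩
  0ℚ ℚ.* ℚ.1/ a          ≡⟨ ℚP.*-zeroˡ (ℚ.1/ a) ⟩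
  0ℚ                     ∎
  where
  open ≡-Reasoning
  instance _ = ℚ.≢-nonZero a≢0

norm≡0⇒≡0q : ∀ x → norm x ≡ 0ℚ → x ≡ 0q
norm≡0⇒≡0q (a +√5· b) norm≡0 = +√5·-cong (a*a≡0⇒a≡0 a a*a≡0) b≡0
  where
  a*a≡5*b*b : a ℚ.* a ≡ 5ℚ ℚ.* b ℚ.* b
  a*a≡5*b*b = GroupProperties.x∙y⁻¹≈ε⇒x≈y ℚP.+-0-group _ _ norm≡0
  b≡0 : b ≡ 0ℚ
  b≡0 = √prime∉ℚ (toWitness {a? = prime? 5} _) a b a*a≡5*b*b
  a*a≡0 : a ℚ.* a ≡ 0ℚ
  a*a≡0 = trans a*a≡5*b*b (cong (λ b → 5ℚ ℚ.* b ℚ.* b) b≡0)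

invℚ-inverseʳ : ∀ q → q ≢ 0ℚ → q ℚ.* invℚ q ≡ 1ℚ
invℚ-inverseʳ q q≢0 with q ℚ.≟ 0ℚ
... | yes q≡0 = contradiction q≡0 q≢0
... | no q≢0′ = ℚP.*-inverseʳ q {{ℚ.≢-nonZero q≢0′}}

*q-inverseʳ : ∀ x → x ≢ 0q → x *q invq x ≡ 1q
*q-inverseʳ x@(a +√5· b) x≢0 = +√5·-cong
  (trans (solve 4 (λ a b f N → a :* (a :* N) :+ f :* b :* (:- b :* N) := (a :* a :- f :* b :* b) :* N)
                  refl a b 5ℚ N⁻¹)
         (invℚ-inverseʳ (norm x) (x≢0 ∘ norm≡0⇒≡0q x)))
  (solve 3 (λ a b N → a :* (:- b :* N) :+ b :* (a :* N) := con 0ℚ) refl a b N⁻¹)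
  where
  open ℚ-Solver.+-*-Solver
  N⁻¹ = invℚ (norm x)

two α β : Q5
two = fromℕ 2
α = three +q √5
β = three -q √5

conj : Q5 → Q5
conj (a +√5· b) = a +√5· (ℚ.- b)

conj-*q : ∀ x y → conj (x *q y) ≡ conj x *q conj y
conj-*q (a +√5· b) (c +√5· d) = +√5·-cong
  (solve 5 (λ a b c d f → a :* c :+ f :* b :* d := a :* c :+ f :* (:- b) :* (:- d)) refl a b c d 5ℚ)
  (solve 4 (λ a b c d → :- (a :* d :+ b :* c) := a :* (:- d) :+ (:- b) :* c) refl a b c d)
  where open ℚ-Solver.+-*-Solver

β^k≡conj[α^k] : ∀ k → β ^q k ≡ conj (α ^q k)
β^k≡conj[α^k] zero = refl
β^k≡conj[α^k] (suc k) = trans (cong (β *q_) (β^k≡conj[α^k] k)) (sym (conj-*q α (α ^q k)))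

im[two^k]≡0 : ∀ k → im (two ^q k) ≡ 0ℚ
im[two^k]≡0 zero = refl
im[two^k]≡0 (suc k) rewrite im[two^k]≡0 k =
  solve 1 (λ r → con (re two) :* con 0ℚ :+ con 0ℚ :* r := con 0ℚ) refl (re (two ^q k))
  where open ℚ-Solver.+-*-Solver

instance
  re-α-positive : ℚ.Positive (re α)
  re-α-positive = _
  im-α-positive : ℚ.Positive (im α)
  im-α-positive = _
  5*im-α-nonNegative : ℚ.NonNegative (5ℚ ℚ.* im α)
  5*im-α-nonNegative = _

α^k-signs : ∀ k → ℚ.Positive (re (α ^q k)) × ℚ.NonNegative (im (α ^q k))
im[α^suc-k]-positive : ∀ k → ℚ.Positive (im (α ^q suc k))

α^k-signs zero = _ , _
α^k-signs (suc k) =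
  ℚP.pos+nonNeg⇒pos (re α ℚ.* a) {{ℚP.pos*pos⇒pos (re α) a {{proj₁ (α^k-signs k)}}}}
                    (5ℚ ℚ.* im α ℚ.* b) {{ℚP.nonNeg*nonNeg⇒nonNeg (5ℚ ℚ.* im α) b {{proj₂ (α^k-signs k)}}}}
  , ℚP.pos⇒nonNeg (im (α ^q suc k)) {{im[α^suc-k]-positive k}}
  where a = re (α ^q k); b = im (α ^q k)

im[α^suc-k]-positive k =
  ℚP.nonNeg+pos⇒pos (re α ℚ.* b) {{ℚP.nonNeg*nonNeg⇒nonNeg (re α) {{ℚP.pos⇒nonNeg (re α)}} b {{proj₂ (α^k-signs k)}}}}
                    (im α ℚ.* a) {{ℚP.pos*pos⇒pos (im α) a {{proj₁ (α^k-signs k)}}}}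
  where a = re (α ^q k); b = im (α ^q k)

positive⇒≢0 : ∀ q → .{{ℚ.Positive q}} → q ≢ 0ℚ
positive⇒≢0 q q≡0 = ℚP.<⇒≢ (ℚP.positive⁻¹ q) (sym q≡0)

-- The √5-part of 2^k vanishes, while that of α^(k+1) is positive and that of β^(k+1) negative.
two^k-α^k≢0q : ∀ k → two ^q suc k -q α ^q suc k ≢ 0q
two^k-α^k≢0q k eq = positive⇒≢0 (im (α ^q suc k)) {{im[α^suc-k]-positive k}}
  (trans (sym (cong im (x-q-y≡0q⇒x≡y (two ^q suc k) (α ^q suc k) eq))) (im[two^k]≡0 (suc k)))

two^k-β^k≢0q : ∀ k → two ^q suc k -q β ^q suc k ≢ 0q
two^k-β^k≢0q k eq = positive⇒≢0 (im (α ^q suc k)) {{im[α^suc-k]-positive k}}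
  (ℚP.neg-injective (trans (sym (cong im two^k≡conj[α^k])) (im[two^k]≡0 (suc k))))
  where
  two^k≡conj[α^k] : two ^q suc k ≡ conj (α ^q suc k)
  two^k≡conj[α^k] = trans (x-q-y≡0q⇒x≡y (two ^q suc k) (β ^q suc k) eq) (β^k≡conj[α^k] (suc k))

fromℕ-suc≢0q : ∀ m → fromℕ (suc m) ≢ 0q
fromℕ-suc≢0q m ()

-- The cyclic recurrence satisfied by b

-- b_e in terms of x = 2^(k−e), y = α^e, z = β^e and the inverses Iα, Iβ of its two denominators.
coefficientShape : (N Iα Iβ x y z : Q5) → Q5
coefficientShape N Iα Iβ x y z = 1q +q ((N *q x) /q √5) *q (y *q Iα -q z *q Iβ)

module _ where
  open Q5-Solver

  private
    Shape : ∀ {v} → (N Iα Iβ x y z : Polynomial v) → Polynomial v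
    Shape N Iα Iβ x y z = con 1q :+ ((N :* x) :* con (invq √5)) :* (y :* Iα :- z :* Iβ)

  shape-three-term : ∀ N Iα Iβ x y z →
    (three *q coefficientShape N Iα Iβ (two *q (two *q x)) (α *q y) (β *q z)
      -q coefficientShape N Iα Iβ (two *q (two *q (two *q x))) y z)
      -q coefficientShape N Iα Iβ (two *q x) (α *q (α *q y)) (β *q (β *q z))
    ≡ 1q
  shape-three-term = solve 6 (λ N Iα Iβ x y z →
    (con three :* Shape N Iα Iβ (con two :* (con two :* x)) (con α :* y) (con β :* z)
      :- Shape N Iα Iβ (con two :* (con two :* (con two :* x))) y z)
      :- Shape N Iα Iβ (con two :* x) (con α :* (con α :* y)) (con β :* (con β :* z))
    := con 1q) refl

  -- Since αβ = 4, the terms wrapping around the cycle combine into multiples of the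
  -- denominators 2^k − α^k and 2^k − β^k.
  shape-wrap-first : ∀ N Iα Iβ x y z →
    (three *q coefficientShape N Iα Iβ (two *q x) 1q 1q
      -q coefficientShape N Iα Iβ (two *q 1q) y z)
      -q coefficientShape N Iα Iβ x (α *q 1q) (β *q 1q)
    ≡ (1q -q N) +q (N /q √5) *q ((β /q two) *q ((two *q x -q α *q y) *q Iα -q 1q)
                                -q (α /q two) *q ((two *q x -q β *q z) *q Iβ -q 1q))
  shape-wrap-first = solve 6 (λ N Iα Iβ x y z →
    (con three :* Shape N Iα Iβ (con two :* x) (con 1q) (con 1q)
      :- Shape N Iα Iβ (con two :* con 1q) y z)
      :- Shape N Iα Iβ x (con α :* con 1q) (con β :* con 1q)
    := (con 1q :- N) :+ (N :* con (invq √5)) :* (con (β /q two) :* ((con two :* x :- con α :* y) :* Iα :- con 1q)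
                                :- con (α /q two) :* ((con two :* x :- con β :* z) :* Iβ :- con 1q))) refl

  shape-wrap-last : ∀ N Iα Iβ x y z →
    (three *q coefficientShape N Iα Iβ (two *q 1q) (α *q y) (β *q z)
      -q coefficientShape N Iα Iβ (two *q (two *q 1q)) y z)
      -q coefficientShape N Iα Iβ (two *q x) 1q 1q
    ≡ 1q +q (N /q √5) *q (((two *q x -q β *q (β *q z)) *q Iβ -q 1q)
                         -q ((two *q x -q α *q (α *q y)) *q Iα -q 1q))
  shape-wrap-last = solve 6 (λ N Iα Iβ x y z →
    (con three :* Shape N Iα Iβ (con two :* con 1q) (con α :* y) (con β :* z)
      :- Shape N Iα Iβ (con two :* (con two :* con 1q)) y z)
      :- Shape N Iα Iβ (con two :* x) (con 1q) (con 1q)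
    := con 1q :+ (N :* con (invq √5)) :* (((con two :* x :- con β :* (con β :* z)) :* Iβ :- con 1q)
                                 :- ((con two :* x :- con α :* (con α :* y)) :* Iα :- con 1q))) refl

  x+y*[c*[1-1]-d*[1-1]]≡x : ∀ x y c d → x +q y *q (c *q (1q -q 1q) -q d *q (1q -q 1q)) ≡ x
  x+y*[c*[1-1]-d*[1-1]]≡x = solve 4 (λ x y c d →
    x :+ y :* (c :* (con 1q :- con 1q) :- d :* (con 1q :- con 1q)) := x) refl

module Coefficients (m : ℕ) where
  K k n : ℕ
  K = suc (suc m)
  k = suc K
  n = suc k

  N Dα Dβ Iα Iβ : Q5
  N = fromℕ n
  Dα = two ^q k -q α ^q k
  Dβ = two ^q k -q β ^q k
  Iα = invq Dα
  Iβ = invq Dβ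

  -- bcoef n j unfolds to b (toℕ j).
  b : ℕ → Q5
  b e = coefficientShape N Iα Iβ (two ^q (k ∸ e)) (α ^q e) (β ^q e)

  b-at : ∀ e t → k ∸ e ≡ t → b e ≡ coefficientShape N Iα Iβ (two ^q t) (α ^q e) (β ^q e)
  b-at e t refl = refl

  b-interior : ∀ e → e ≤ m → (three *q b (suc e) -q b e) -q b (suc (suc e)) ≡ 1q
  b-interior e e≤m = begin
    (three *q b (suc e) -q b e) -q b (suc (suc e))
      ≡⟨ cong₂ _-q_ (cong₂ _-q_ (cong (three *q_) (b-at (suc e) _ (ℕP.+-∸-assoc 2 e≤m)))
                                  (b-at e _ (ℕP.+-∸-assoc 3 e≤m)))
                    (b-at (suc (suc e)) _ (ℕP.+-∸-assoc 1 e≤m)) ⟩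
    (three *q coefficientShape N Iα Iβ (two *q (two *q x)) (α *q y) (β *q z)
      -q coefficientShape N Iα Iβ (two *q (two *q (two *q x))) y z)
      -q coefficientShape N Iα Iβ (two *q x) (α *q (α *q y)) (β *q (β *q z))
      ≡⟨ shape-three-term N Iα Iβ x y z ⟩
    1q ∎
    where
    open ≡-Reasoning
    x = two ^q (m ∸ e); y = α ^q e; z = β ^q e

  b-first : (three *q b 0 -q b K) -q b 1 ≡ 1q -q N
  b-first = begin
    (three *q b 0 -q b K) -q b 1
      ≡⟨ cong (λ w → (three *q b 0 -q w) -q b 1) (b-at K 1 (ℕP.m+n∸n≡m 1 K)) ⟩
    (three *q coefficientShape N Iα Iβ (two *q x) 1q 1q
      -q coefficientShape N Iα Iβ (two *q 1q) y z)
      -q coefficientShape N Iα Iβ x (α *q 1q) (β *q 1q)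
      ≡⟨ shape-wrap-first N Iα Iβ x y z ⟩
    (1q -q N) +q (N /q √5) *q ((β /q two) *q (Dα *q Iα -q 1q) -q (α /q two) *q (Dβ *q Iβ -q 1q))
      ≡⟨ cong₂ (λ u v → (1q -q N) +q (N /q √5) *q ((β /q two) *q (u -q 1q) -q (α /q two) *q (v -q 1q)))
               (*q-inverseʳ Dα (two^k-α^k≢0q K)) (*q-inverseʳ Dβ (two^k-β^k≢0q K)) ⟩
    (1q -q N) +q (N /q √5) *q ((β /q two) *q (1q -q 1q) -q (α /q two) *q (1q -q 1q))
      ≡⟨ x+y*[c*[1-1]-d*[1-1]]≡x (1q -q N) (N /q √5) (β /q two) (α /q two) ⟩
    1q -q N ∎
    where
    open ≡-Reasoning
    x = two ^q K; y = α ^q K; z = β ^q K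

  b-last : (three *q b K -q b (suc m)) -q b 0 ≡ 1q
  b-last = begin
    (three *q b K -q b (suc m)) -q b 0
      ≡⟨ cong₂ (λ u w → (three *q u -q w) -q b 0) (b-at K 1 (ℕP.m+n∸n≡m 1 K))
                                                  (b-at (suc m) 2 (ℕP.m+n∸n≡m 2 (suc m))) ⟩
    (three *q coefficientShape N Iα Iβ (two *q 1q) (α *q y) (β *q z)
      -q coefficientShape N Iα Iβ (two *q (two *q 1q)) y z)
      -q coefficientShape N Iα Iβ (two *q x) 1q 1q
      ≡⟨ shape-wrap-last N Iα Iβ x y z ⟩
    1q +q (N /q √5) *q ((Dβ *q Iβ -q 1q) -q (Dα *q Iα -q 1q))
      ≡⟨ cong₂ (λ u v → 1q +q (N /q √5) *q ((u -q 1q) -q (v -q 1q)))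
               (*q-inverseʳ Dβ (two^k-β^k≢0q K)) (*q-inverseʳ Dα (two^k-α^k≢0q K)) ⟩
    1q +q (N /q √5) *q ((1q -q 1q) -q (1q -q 1q))
      ≡⟨ x+y*[c*[1-1]-d*[1-1]]≡x 1q (N /q √5) 1q 1q ⟩
    1q ∎
    where
    open ≡-Reasoning
    x = two ^q K; y = α ^q suc m; z = β ^q suc m

-- Finite sums and matrix products

open SemiringSum (CommutativeRing.semiring Q5-commutativeRing)
  using (sum; sum-cong-≗; ∑-distrib-+; ∑-comm; *-distribˡ-sum)

Σq≡sum : ∀ k (f : Fin k → Q5) → Σq k f ≡ sum f
Σq≡sum zero f = refl
Σq≡sum (suc k) f = cong (f zero +q_) (Σq≡sum k (λ i → f (suc i)))

module _ {k : ℕ} where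
  Σq-cong : ∀ {f g : Fin k → Q5} → (∀ i → f i ≡ g i) → Σq k f ≡ Σq k g
  Σq-cong {f} {g} f≗g = trans (Σq≡sum k f) (trans (sum-cong-≗ f≗g) (sym (Σq≡sum k g)))

  Σq-+q : ∀ (f g : Fin k → Q5) → Σq k (λ i → f i +q g i) ≡ Σq k f +q Σq k g
  Σq-+q f g = trans (Σq≡sum k _) (trans (∑-distrib-+ f g) (sym (cong₂ _+q_ (Σq≡sum k f) (Σq≡sum k g))))

  Σq-*ˡ : ∀ c (f : Fin k → Q5) → Σq k (λ i → c *q f i) ≡ c *q Σq k f
  Σq-*ˡ c f = trans (Σq≡sum k _) (trans (sym (*-distribˡ-sum c f)) (sym (cong (c *q_) (Σq≡sum k f))))

  Σq-*ʳ : ∀ c (f : Fin k → Q5) → Σq k (λ i → f i *q c) ≡ Σq k f *q c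
  Σq-*ʳ c f = trans (Σq-cong (λ i → *q-comm (f i) c)) (trans (Σq-*ˡ c f) (*q-comm c _))

  Σq--q : ∀ (f g : Fin k → Q5) → Σq k (λ i → f i -q g i) ≡ Σq k f -q Σq k g
  Σq--q f g = begin
    Σq k (λ i → f i +q -q g i)             ≡⟨ Σq-+q f (λ i → -q g i) ⟩
    Σq k f +q Σq k (λ i → -q g i)          ≡⟨ cong (Σq k f +q_) (Σq-cong (λ i → sym (-1*x≈-x (g i)))) ⟩
    Σq k f +q Σq k (λ i → -q 1q *q g i)    ≡⟨ cong (Σq k f +q_) (Σq-*ˡ (-q 1q) g) ⟩
    Σq k f +q -q 1q *q Σq k g              ≡⟨ cong (Σq k f +q_) (-1*x≈-x (Σq k g)) ⟩
    Σq k f -q Σq k g                       ∎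
    where
    open ≡-Reasoning
    open RingProperties (CommutativeRing.ring Q5-commutativeRing) using (-1*x≈-x)

Σq-comm : ∀ a b (f : Fin a → Fin b → Q5) →
  Σq a (λ i → Σq b (f i)) ≡ Σq b (λ j → Σq a (λ i → f i j))
Σq-comm a b f = begin
  Σq a (λ i → Σq b (f i))            ≡⟨ Σq-cong (λ i → Σq≡sum b (f i)) ⟩
  Σq a (λ i → sum (f i))             ≡⟨ Σq≡sum a _ ⟩
  sum (λ i → sum (f i))              ≡⟨ ∑-comm f ⟩
  sum (λ j → sum (λ i → f i j))      ≡⟨ Σq≡sum b _ ⟨
  Σq b (λ j → sum (λ i → f i j))     ≡⟨ Σq-cong (λ j → Σq≡sum a _) ⟨
  Σq b (λ j → Σq a (λ i → f i j))    ∎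
  where open ≡-Reasoning

δ : ∀ {k} → Fin k → Fin k → Q5
δ {k} = Iₘ k

δ-≡ : ∀ {k} {i j : Fin k} → i ≡ j → δ i j ≡ 1q
δ-≡ {i = i} {j} i≡j with toℕ i ℕ.≟ toℕ j
... | yes _ = refl
... | no i≢j = contradiction (cong toℕ i≡j) i≢j

δ-≢ : ∀ {k} {i j : Fin k} → i ≢ j → δ i j ≡ 0q
δ-≢ {i = i} {j} i≢j with toℕ i ℕ.≟ toℕ j
... | yes i≡j = contradiction (FinP.toℕ-injective i≡j) i≢j
... | no _ = refl

δ-cong : ∀ {k k′} {i j : Fin k} {i′ j′ : Fin k′} → (i ≡ j → i′ ≡ j′) → (i′ ≡ j′ → i ≡ j) → δ i j ≡ δ i′ j′
δ-cong {i = i} {j} to from with i Fin.≟ j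
... | yes i≡j = trans (δ-≡ i≡j) (sym (δ-≡ (to i≡j)))
... | no i≢j = trans (δ-≢ i≢j) (sym (δ-≢ (λ i′≡j′ → i≢j (from i′≡j′))))

δ-sym : ∀ {k} (i j : Fin k) → δ i j ≡ δ j i
δ-sym i j = δ-cong {i = i} {j} sym sym

Σq-δ : ∀ {k} (i : Fin k) (f : Fin k → Q5) → Σq k (λ l → δ i l *q f l) ≡ f i
Σq-δ {suc k} zero f = begin
  δ {suc k} zero zero *q f zero +q Σq k (λ l → δ zero (suc l) *q f (suc l))
    ≡⟨ cong₂ _+q_ (cong (_*q f zero) (δ-≡ {suc k} {zero} refl))
                  (Σq-cong (λ l → cong (_*q f (suc l)) (δ-≢ {i = zero} {suc l} (λ ())))) ⟩
  1q *q f zero +q Σq k (λ l → 0q *q f (suc l))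
    ≡⟨ cong₂ _+q_ (*q-identityˡ (f zero))
                  (trans (Σq-*ˡ 0q (λ l → f (suc l))) (zeroˡ (Σq k (λ l → f (suc l))))) ⟩
  f zero +q 0q
    ≡⟨ +q-identityʳ (f zero) ⟩
  f zero ∎
  where
  open ≡-Reasoning
  open CommutativeRing Q5-commutativeRing using (zeroˡ)
Σq-δ {suc k} (suc i) f = begin
  δ {suc k} (suc i) zero *q f zero +q Σq k (λ l → δ (suc i) (suc l) *q f (suc l))
    ≡⟨ cong₂ _+q_ (cong (_*q f zero) (δ-≢ {i = suc i} {zero} (λ ())))
                  (Σq-cong (λ l → cong (_*q f (suc l)) (δ-cong {i = suc i} {suc l} FinP.suc-injective (cong suc)))) ⟩
  0q *q f zero +q Σq k (λ l → δ i l *q f (suc l))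
    ≡⟨ cong₂ _+q_ (zeroˡ (f zero)) (Σq-δ i (λ l → f (suc l))) ⟩
  0q +q f (suc i)
    ≡⟨ +q-identityˡ (f (suc i)) ⟩
  f (suc i) ∎
  where
  open ≡-Reasoning
  open CommutativeRing Q5-commutativeRing using (zeroˡ)

Σq-δ-difference : ∀ {k} (a b : Fin k) (f : Fin k → Q5) →
  Σq k (λ l → (δ a l -q δ b l) *q f l) ≡ f a -q f b
Σq-δ-difference {k} a b f = begin
  Σq k (λ l → (δ a l -q δ b l) *q f l)
    ≡⟨ Σq-cong (λ l → distrib (δ a l) (δ b l) (f l)) ⟩
  Σq k (λ l → δ a l *q f l -q δ b l *q f l)
    ≡⟨ Σq--q (λ l → δ a l *q f l) (λ l → δ b l *q f l) ⟩
  Σq k (λ l → δ a l *q f l) -q Σq k (λ l → δ b l *q f l)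
    ≡⟨ cong₂ _-q_ (Σq-δ a f) (Σq-δ b f) ⟩
  f a -q f b ∎
  where
  open ≡-Reasoning
  open Q5-Solver
  distrib : ∀ x y z → (x -q y) *q z ≡ x *q z -q y *q z
  distrib = solve 3 (λ x y z → (x :- y) :* z := x :* z :- y :* z) refl

Σq-δ-second-difference : ∀ {k} (c : Q5) (a b e : Fin k) (f : Fin k → Q5) →
  Σq k (λ l → ((c *q δ a l -q δ b l) -q δ e l) *q f l) ≡ (c *q f a -q f b) -q f e
Σq-δ-second-difference {k} c a b e f = begin
  Σq k (λ l → ((c *q δ a l -q δ b l) -q δ e l) *q f l)
    ≡⟨ Σq-cong (λ l → distrib c (δ a l) (δ b l) (δ e l) (f l)) ⟩
  Σq k (λ l → (c *q (δ a l *q f l) -q δ b l *q f l) -q δ e l *q f l)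
    ≡⟨ Σq--q (λ l → c *q (δ a l *q f l) -q δ b l *q f l) (λ l → δ e l *q f l) ⟩
  Σq k (λ l → c *q (δ a l *q f l) -q δ b l *q f l) -q Σq k (λ l → δ e l *q f l)
    ≡⟨ cong (_-q Σq k (λ l → δ e l *q f l)) (Σq--q (λ l → c *q (δ a l *q f l)) (λ l → δ b l *q f l)) ⟩
  (Σq k (λ l → c *q (δ a l *q f l)) -q Σq k (λ l → δ b l *q f l)) -q Σq k (λ l → δ e l *q f l)
    ≡⟨ cong₂ _-q_ (cong₂ _-q_ (trans (Σq-*ˡ c (λ l → δ a l *q f l)) (cong (c *q_) (Σq-δ a f))) (Σq-δ b f))
                  (Σq-δ e f) ⟩
  (c *q f a -q f b) -q f e ∎
  where
  open ≡-Reasoning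
  open Q5-Solver
  distrib : ∀ c x y z w → ((c *q x -q y) -q z) *q w ≡ (c *q (x *q w) -q y *q w) -q z *q w
  distrib = solve 5 (λ c x y z w → ((c :* x :- y) :- z) :* w := (c :* (x :* w) :- y :* w) :- z :* w)
                    refl

⊗-cong : ∀ {k} {A A′ B B′ : Mat k} → A ≐ A′ → B ≐ B′ → (A ⊗ B) ≐ (A′ ⊗ B′)
⊗-cong A≐A′ B≐B′ i j = Σq-cong (λ l → cong₂ _*q_ (A≐A′ i l) (B≐B′ l j))

⊗-assoc : ∀ {k} (A B C : Mat k) → ((A ⊗ B) ⊗ C) ≐ (A ⊗ (B ⊗ C))
⊗-assoc {k} A B C i j = begin
  Σq k (λ l → Σq k (λ t → A i t *q B t l) *q C l j)     ≡⟨ Σq-cong (λ l → Σq-*ʳ (C l j) _) ⟨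
  Σq k (λ l → Σq k (λ t → A i t *q B t l *q C l j))     ≡⟨ Σq-comm k k _ ⟩
  Σq k (λ t → Σq k (λ l → A i t *q B t l *q C l j))     ≡⟨ Σq-cong (λ t → Σq-cong (λ l → *q-assoc (A i t) (B t l) (C l j))) ⟩
  Σq k (λ t → Σq k (λ l → A i t *q (B t l *q C l j)))   ≡⟨ Σq-cong (λ t → Σq-*ˡ (A i t) _) ⟩
  Σq k (λ t → A i t *q Σq k (λ l → B t l *q C l j))     ∎
  where open ≡-Reasoning

Iₘ-⊗ : ∀ {k} (A : Mat k) → (Iₘ k ⊗ A) ≐ A
Iₘ-⊗ A i j = Σq-δ i (λ l → A l j)

A⊗Aᵀ⊕I-symmetric : ∀ {k} (A : Mat k) i j →
  ((A ⊗ transpose A) ⊕ Iₘ k) i j ≡ ((A ⊗ transpose A) ⊕ Iₘ k) j i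
A⊗Aᵀ⊕I-symmetric A i j = cong₂ _+q_ (Σq-cong (λ l → *q-comm (A i l) (A j l))) (δ-sym i j)

left-inverse-solves : ∀ {k} (X M B R : Mat k) → (X ⊗ M) ≐ Iₘ k → (M ⊗ B) ≐ R → (X ⊗ R) ≐ B
left-inverse-solves {k} X M B R X⊗M≐I M⊗B≐R i j = begin
  (X ⊗ R) i j           ≡⟨ ⊗-cong {A = X} (λ _ _ → refl) M⊗B≐R i j ⟨
  (X ⊗ (M ⊗ B)) i j     ≡⟨ ⊗-assoc X M B i j ⟨
  ((X ⊗ M) ⊗ B) i j     ≡⟨ ⊗-cong {B = B} X⊗M≐I (λ _ _ → refl) i j ⟩
  (Iₘ k ⊗ B) i j        ≡⟨ Iₘ-⊗ B i j ⟩
  B i j                 ∎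
  where open ≡-Reasoning

-- Cyclic index arithmetic

module Cyclic (K : ℕ) where
  open ℕ-Solver.+-*-Solver

  k : ℕ
  k = suc K

  [_] : ℕ → Fin k
  [ a ] = a mod k

  toℕ-[] : ∀ a → toℕ [ a ] ≡ a % k
  toℕ-[] a = FinP.toℕ-fromℕ< _

  []-cong-% : ∀ a b → a % k ≡ b % k → [ a ] ≡ [ b ]
  []-cong-% a b eq = FinP.toℕ-injective (trans (toℕ-[] a) (trans eq (sym (toℕ-[] b))))

  [toℕ] : ∀ i → [ toℕ i ] ≡ i
  [toℕ] i = FinP.toℕ-injective (trans (toℕ-[] (toℕ i)) (m<n⇒m%n≡m (FinP.toℕ<n i)))

  [+k] : ∀ a → [ a + k ] ≡ [ a ]
  [+k] a = []-cong-% (a + k) a ([m+n]%n≡m%n a k)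

  [[]+] : ∀ a b → [ toℕ [ a ] + b ] ≡ [ a + b ]
  [[]+] a b = []-cong-% (toℕ [ a ] + b) (a + b) (begin
    (toℕ [ a ] + b) % k          ≡⟨ cong (λ x → (x + b) % k) (toℕ-[] a) ⟩
    (a % k + b) % k              ≡⟨ %-distribˡ-+ (a % k) b k ⟩
    (a % k % k + b % k) % k      ≡⟨ cong (λ x → (x + b % k) % k) (m%n%n≡m%n a k) ⟩
    (a % k + b % k) % k          ≡⟨ %-distribˡ-+ a b k ⟨
    (a + b) % k                  ∎)
    where open ≡-Reasoning

  [+[]] : ∀ a b → [ a + toℕ [ b ] ] ≡ [ a + b ]
  [+[]] a b = begin
    [ a + toℕ [ b ] ]   ≡⟨ cong [_] (ℕP.+-comm a _) ⟩
    [ toℕ [ b ] + a ]   ≡⟨ [[]+] b a ⟩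
    [ b + a ]           ≡⟨ cong [_] (ℕP.+-comm b a) ⟩
    [ a + b ]           ∎
    where open ≡-Reasoning

  [[]+[]] : ∀ a b → [ toℕ [ a ] + toℕ [ b ] ] ≡ [ a + b ]
  [[]+[]] a b = trans ([[]+] a (toℕ [ b ])) ([+[]] a b)

  next prev : Fin k → Fin k
  next i = [ toℕ i + 1 ]
  prev i = [ toℕ i + K ]

  -- offset i j is, definitionally, the index (j − i) mod k that circ k uses for the entry (i, j).
  offset : Fin k → Fin k → Fin k
  offset i j = [ toℕ j + (k ∸ toℕ i) ]

  i+[k∸i]≡k : ∀ (i : Fin k) → toℕ i + (k ∸ toℕ i) ≡ k
  i+[k∸i]≡k i = ℕP.m+[n∸m]≡n (ℕP.<⇒≤ (FinP.toℕ<n i))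

  swap-+ : ∀ a b c → a + (b + c) ≡ b + (a + c)
  swap-+ = solve 3 (λ a b c → a :+ (b :+ c) := b :+ (a :+ c)) refl

  offset-spec : ∀ i j → [ toℕ i + toℕ (offset i j) ] ≡ j
  offset-spec i j = begin
    [ toℕ i + toℕ (offset i j) ]          ≡⟨ [+[]] (toℕ i) _ ⟩
    [ toℕ i + (toℕ j + (k ∸ toℕ i)) ]     ≡⟨ cong [_] (swap-+ (toℕ i) (toℕ j) (k ∸ toℕ i)) ⟩
    [ toℕ j + (toℕ i + (k ∸ toℕ i)) ]     ≡⟨ cong (λ x → [ toℕ j + x ]) (i+[k∸i]≡k i) ⟩
    [ toℕ j + k ]                         ≡⟨ [+k] (toℕ j) ⟩
    [ toℕ j ]                             ≡⟨ [toℕ] j ⟩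
    j                                     ∎
    where open ≡-Reasoning

  offset-unique : ∀ i e → offset i [ toℕ i + toℕ e ] ≡ e
  offset-unique i e = begin
    [ toℕ [ toℕ i + toℕ e ] + (k ∸ toℕ i) ]   ≡⟨ [[]+] (toℕ i + toℕ e) _ ⟩
    [ toℕ i + toℕ e + (k ∸ toℕ i) ]           ≡⟨ cong [_] (trans (ℕP.+-assoc (toℕ i) (toℕ e) _) (swap-+ (toℕ i) (toℕ e) _)) ⟩
    [ toℕ e + (toℕ i + (k ∸ toℕ i)) ]         ≡⟨ cong (λ x → [ toℕ e + x ]) (i+[k∸i]≡k i) ⟩
    [ toℕ e + k ]                             ≡⟨ [+k] (toℕ e) ⟩
    [ toℕ e ]                                 ≡⟨ [toℕ] e ⟩
    e                                         ∎
    where open ≡-Reasoning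

  offset-char : ∀ i j e → [ toℕ i + toℕ e ] ≡ j → offset i j ≡ e
  offset-char i _ e refl = offset-unique i e

  next-prev : ∀ i → next (prev i) ≡ i
  next-prev i = begin
    [ toℕ [ toℕ i + K ] + 1 ]   ≡⟨ [[]+] (toℕ i + K) 1 ⟩
    [ toℕ i + K + 1 ]           ≡⟨ cong [_] (solve 2 (λ i K → i :+ K :+ con 1 := i :+ (con 1 :+ K)) refl (toℕ i) K) ⟩
    [ toℕ i + k ]               ≡⟨ [+k] (toℕ i) ⟩
    [ toℕ i ]                   ≡⟨ [toℕ] i ⟩
    i                           ∎
    where open ≡-Reasoning

  prev-next : ∀ i → prev (next i) ≡ i
  prev-next i = begin
    [ toℕ [ toℕ i + 1 ] + K ]   ≡⟨ [[]+] (toℕ i + 1) K ⟩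
    [ toℕ i + 1 + K ]           ≡⟨ cong [_] (ℕP.+-assoc (toℕ i) 1 K) ⟩
    [ toℕ i + k ]               ≡⟨ [+k] (toℕ i) ⟩
    [ toℕ i ]                   ≡⟨ [toℕ] i ⟩
    i                           ∎
    where open ≡-Reasoning

  offset-spec-+k : ∀ a b i j → a + b ≡ toℕ i + toℕ (offset i j) + k → [ toℕ [ a ] + toℕ [ b ] ] ≡ j
  offset-spec-+k a b i j eq = begin
    [ toℕ [ a ] + toℕ [ b ] ]              ≡⟨ [[]+[]] a b ⟩
    [ a + b ]                              ≡⟨ cong [_] eq ⟩
    [ toℕ i + toℕ (offset i j) + k ]       ≡⟨ [+k] (toℕ i + toℕ (offset i j)) ⟩
    [ toℕ i + toℕ (offset i j) ]           ≡⟨ offset-spec i j ⟩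
    j                                      ∎
    where open ≡-Reasoning

  offset-nextˡ : ∀ i j → offset (next i) j ≡ prev (offset i j)
  offset-nextˡ i j = offset-char (next i) j (prev (offset i j))
    (offset-spec-+k (toℕ i + 1) (toℕ (offset i j) + K) i j (solve 3 (λ i d K → i :+ con 1 :+ (d :+ K) := i :+ d :+ (con 1 :+ K)) refl (toℕ i) (toℕ (offset i j)) K))

  offset-prevˡ : ∀ i j → offset (prev i) j ≡ next (offset i j)
  offset-prevˡ i j = offset-char (prev i) j (next (offset i j))
    (offset-spec-+k (toℕ i + K) (toℕ (offset i j) + 1) i j (solve 3 (λ i d K → i :+ K :+ (d :+ con 1) := i :+ d :+ (con 1 :+ K)) refl (toℕ i) (toℕ (offset i j)) K))

  offset-spec-+ : ∀ s i j → [ toℕ i + toℕ [ toℕ (offset i j) + s ] ] ≡ [ toℕ j + s ]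
  offset-spec-+ s i j = begin
    [ toℕ i + toℕ [ d + s ] ]   ≡⟨ [+[]] (toℕ i) (d + s) ⟩
    [ toℕ i + (d + s) ]         ≡⟨ cong [_] (ℕP.+-assoc (toℕ i) d s) ⟨
    [ toℕ i + d + s ]           ≡⟨ [[]+] (toℕ i + d) s ⟨
    [ toℕ [ toℕ i + d ] + s ]   ≡⟨ cong (λ x → [ toℕ x + s ]) (offset-spec i j) ⟩
    [ toℕ j + s ]               ∎
    where
    open ≡-Reasoning
    d = toℕ (offset i j)

  offset-nextʳ : ∀ i j → offset i (next j) ≡ next (offset i j)
  offset-nextʳ i j = offset-char i (next j) (next (offset i j)) (offset-spec-+ 1 i j)

  offset-prevʳ : ∀ i j → offset i (prev j) ≡ prev (offset i j)
  offset-prevʳ i j = offset-char i (prev j) (prev (offset i j)) (offset-spec-+ K i j)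

  offset≡0⇒≡ : ∀ {i j} → offset i j ≡ zero → i ≡ j
  offset≡0⇒≡ {i} {j} eq = begin
    i                              ≡⟨ [toℕ] i ⟨
    [ toℕ i ]                      ≡⟨ cong [_] (ℕP.+-identityʳ (toℕ i)) ⟨
    [ toℕ i + toℕ {k} zero ]       ≡⟨ cong (λ e → [ toℕ i + toℕ e ]) eq ⟨
    [ toℕ i + toℕ (offset i j) ]   ≡⟨ offset-spec i j ⟩
    j                              ∎
    where open ≡-Reasoning

  offset-self : ∀ i → offset i i ≡ zero
  offset-self i = offset-char i i zero (trans (cong [_] (ℕP.+-identityʳ (toℕ i))) ([toℕ] i))

  toℕ-prev-zero : toℕ (prev zero) ≡ K
  toℕ-prev-zero = trans (toℕ-[] K) (m<n⇒m%n≡m (ℕP.n<1+n K))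

  toℕ-prev-suc : ∀ {i e} → toℕ i ≡ suc e → toℕ (prev i) ≡ e
  toℕ-prev-suc {i} {e} i≡1+e = begin
    toℕ [ toℕ i + K ]   ≡⟨ toℕ-[] (toℕ i + K) ⟩
    (toℕ i + K) % k     ≡⟨ cong (λ x → (x + K) % k) i≡1+e ⟩
    (suc e + K) % k     ≡⟨ cong (_% k) (ℕP.+-suc e K) ⟨
    (e + k) % k         ≡⟨ [m+n]%n≡m%n e k ⟩
    e % k               ≡⟨ m<n⇒m%n≡m (ℕP.<-trans (ℕP.n<1+n e) (subst (_< k) i≡1+e (FinP.toℕ<n i))) ⟩
    e                   ∎
    where open ≡-Reasoning

  toℕ-next-< : ∀ {i} → toℕ i < K → toℕ (next i) ≡ suc (toℕ i)
  toℕ-next-< {i} i<K = begin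
    toℕ [ toℕ i + 1 ]   ≡⟨ toℕ-[] (toℕ i + 1) ⟩
    (toℕ i + 1) % k     ≡⟨ m<n⇒m%n≡m (s≤s (subst (_≤ K) (ℕP.+-comm 1 (toℕ i)) i<K)) ⟩
    toℕ i + 1           ≡⟨ ℕP.+-comm (toℕ i) 1 ⟩
    suc (toℕ i)         ∎
    where open ≡-Reasoning

  next-last : ∀ {i} → toℕ i ≡ K → next i ≡ zero
  next-last {i} i≡K = trans (cong (λ x → [ x + 1 ]) i≡K) (trans (cong [_] (ℕP.+-comm K 1)) ([+k] 0))

  prev≢id : K ≢ 0 → ∀ i → prev i ≢ i
  prev≢id K≢0 i prev-i≡i = K≢0 (begin
    K                         ≡⟨ toℕ-prev-zero ⟨
    toℕ (prev zero)           ≡⟨ cong (toℕ ∘ prev) (offset-self i) ⟨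
    toℕ (prev (offset i i))   ≡⟨ cong toℕ (offset-prevʳ i i) ⟨
    toℕ (offset i (prev i))   ≡⟨ cong (toℕ ∘ offset i) prev-i≡i ⟩
    toℕ (offset i i)          ≡⟨ cong toℕ (offset-self i) ⟩
    0                         ∎)
    where open ≡-Reasoning

  offset-injectiveʳ : ∀ i {j j′} → offset i j ≡ offset i j′ → j ≡ j′
  offset-injectiveʳ i {j} {j′} eq = begin
    j                               ≡⟨ offset-spec i j ⟨
    [ toℕ i + toℕ (offset i j) ]    ≡⟨ cong (λ e → [ toℕ i + toℕ e ]) eq ⟩
    [ toℕ i + toℕ (offset i j′) ]   ≡⟨ offset-spec i j′ ⟩
    j′                              ∎
    where open ≡-Reasoning

-- C Cᵀ + I acting on circulant matrices

module Circulant (K′ : ℕ) where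
  K : ℕ
  K = suc K′

  open Cyclic K public

  cC-last : ∀ {j} → toℕ j ≡ K → cC k j ≡ -q 1q
  cC-last {j} j≡K with toℕ j ℕ.≟ 0
  ... | yes j≡0 = contradiction (trans (sym j≡K) j≡0) (λ ())
  ... | no _ with toℕ j ℕ.≟ K
  ...   | yes _ = refl
  ...   | no j≢K = contradiction j≡K j≢K

  cC-other : ∀ {j} → toℕ j ≢ 0 → toℕ j ≢ K → cC k j ≡ 0q
  cC-other {j} j≢0 j≢K with toℕ j ℕ.≟ 0
  ... | yes j≡0 = contradiction j≡0 j≢0
  ... | no _ with toℕ j ℕ.≟ K
  ...   | yes j≡K = contradiction j≡K j≢K
  ...   | no _ = refl

  prev-i≢i : ∀ i → prev i ≢ i
  prev-i≢i = prev≢id (λ ())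

  C-entry : ∀ i t → Cₘ (suc k) i t ≡ δ i t -q δ (prev i) t
  C-entry i t with t Fin.≟ i
  ... | yes refl = trans (cong (cC k) (offset-self i))
                         (sym (cong₂ _-q_ (δ-≡ {i = i} refl) (δ-≢ (prev-i≢i i))))
  ... | no t≢i with t Fin.≟ prev i
  ...   | yes refl = trans (cC-last (trans (cong toℕ (offset-prevʳ i i))
                                         (trans (cong (toℕ ∘ prev) (offset-self i)) toℕ-prev-zero)))
                           (sym (cong₂ _-q_ (δ-≢ (prev-i≢i i ∘ sym)) (δ-≡ {i = prev i} refl)))
  ...   | no t≢prev-i = trans (cC-other offset≢0 offset≢K)
                            (sym (cong₂ _-q_ (δ-≢ (t≢i ∘ sym)) (δ-≢ (t≢prev-i ∘ sym))))
    where
    offset≢0 : toℕ (offset i t) ≢ 0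
    offset≢0 eq = t≢i (sym (offset≡0⇒≡ (FinP.toℕ-injective eq)))
    offset≢K : toℕ (offset i t) ≢ K
    offset≢K eq = t≢prev-i (offset-injectiveʳ i (begin
      offset i t          ≡⟨ FinP.toℕ-injective (trans eq (sym toℕ-prev-zero)) ⟩
      prev zero           ≡⟨ cong prev (offset-self i) ⟨
      prev (offset i i)   ≡⟨ offset-prevʳ i i ⟨
      offset i (prev i)   ∎))
      where open ≡-Reasoning

  M-row : ∀ i l → Mₘ (suc k) i l ≡ (three *q δ i l -q δ (prev i) l) -q δ (next i) l
  M-row i l = begin
    Σq k (λ t → C i t *q C l t) +q δ i l
      ≡⟨ cong (_+q δ i l) (Σq-cong (λ t → cong (_*q C l t) (C-entry i t))) ⟩
    Σq k (λ t → (δ i t -q δ (prev i) t) *q C l t) +q δ i l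
      ≡⟨ cong (_+q δ i l) (Σq-δ-difference i (prev i) (C l)) ⟩
    (C l i -q C l (prev i)) +q δ i l
      ≡⟨ cong (_+q δ i l) (cong₂ _-q_ (C-entry l i) (C-entry l (prev i))) ⟩
    ((δ l i -q δ (prev l) i) -q (δ l (prev i) -q δ (prev l) (prev i))) +q δ i l
      ≡⟨ cong (_+q δ i l) (cong₂ _-q_ (cong₂ _-q_ (δ-sym l i) δ[prev-l,i]≡δ[next-i,l])
                                       (cong₂ _-q_ (δ-sym l (prev i)) δ[prev-l,prev-i]≡δ[i,l])) ⟩
    ((δ i l -q δ (next i) l) -q (δ (prev i) l -q δ i l)) +q δ i l
      ≡⟨ collect (δ i l) (δ (next i) l) (δ (prev i) l) ⟩
    (three *q δ i l -q δ (prev i) l) -q δ (next i) l ∎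
    where
    open ≡-Reasoning
    open Q5-Solver
    C = Cₘ (suc k)
    δ[prev-l,i]≡δ[next-i,l] : δ (prev l) i ≡ δ (next i) l
    δ[prev-l,i]≡δ[next-i,l] =
      δ-cong (λ prev-l≡i → trans (cong next (sym prev-l≡i)) (next-prev l))
             (λ next-i≡l → trans (cong prev (sym next-i≡l)) (prev-next i))
    δ[prev-l,prev-i]≡δ[i,l] : δ (prev l) (prev i) ≡ δ i l
    δ[prev-l,prev-i]≡δ[i,l] =
      δ-cong (λ prev-l≡prev-i → trans (sym (next-prev i)) (trans (cong next (sym prev-l≡prev-i)) (next-prev l)))
             (λ i≡l → cong prev (sym i≡l))
    collect : ∀ a b c → ((a -q b) -q (c -q a)) +q a ≡ (three *q a -q c) -q b
    collect = solve 3 (λ a b c → ((a :- b) :- (c :- a)) :+ a := (con three :* a :- c) :- b) refl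

  Δ : (Fin k → Q5) → Fin k → Q5
  Δ c d = (three *q c d -q c (prev d)) -q c (next d)

  M-column : ∀ l j → Mₘ (suc k) l j ≡ (three *q δ j l -q δ (prev j) l) -q δ (next j) l
  M-column l j = trans (A⊗Aᵀ⊕I-symmetric (Cₘ (suc k)) l j) (M-row j l)

  circ⊗M : ∀ c → (circ k c ⊗ Mₘ (suc k)) ≐ circ k (Δ c)
  circ⊗M c i j = begin
    Σq k (λ l → c (offset i l) *q Mₘ (suc k) l j)
      ≡⟨ Σq-cong (λ l → trans (*q-comm (c (offset i l)) (Mₘ (suc k) l j))
                              (cong (_*q c (offset i l)) (M-column l j))) ⟩
    Σq k (λ l → ((three *q δ j l -q δ (prev j) l) -q δ (next j) l) *q c (offset i l))
      ≡⟨ Σq-δ-second-difference three j (prev j) (next j) (c ∘ offset i) ⟩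
    (three *q c (offset i j) -q c (offset i (prev j))) -q c (offset i (next j))
      ≡⟨ cong₂ (λ u v → (three *q c (offset i j) -q c u) -q c v) (offset-prevʳ i j) (offset-nextʳ i j) ⟩
    Δ c (offset i j) ∎
    where open ≡-Reasoning

  M⊗circ : ∀ c → (Mₘ (suc k) ⊗ circ k c) ≐ circ k (Δ c)
  M⊗circ c i j = begin
    Σq k (λ l → Mₘ (suc k) i l *q c (offset l j))
      ≡⟨ Σq-cong (λ l → cong (_*q c (offset l j)) (M-row i l)) ⟩
    Σq k (λ l → ((three *q δ i l -q δ (prev i) l) -q δ (next i) l) *q c (offset l j))
      ≡⟨ Σq-δ-second-difference three i (prev i) (next i) (λ l → c (offset l j)) ⟩
    (three *q c (offset i j) -q c (offset (prev i) j)) -q c (offset (next i) j)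
      ≡⟨ cong₂ (λ u v → (three *q c (offset i j) -q c u) -q c v) (offset-prevˡ i j) (offset-nextˡ i j) ⟩
    (three *q c d -q c (next d)) -q c (prev d)
      ≡⟨ swap (three *q c d) (c (next d)) (c (prev d)) ⟩
    Δ c d ∎
    where
    open ≡-Reasoning
    open Q5-Solver
    d = offset i j
    swap : ∀ x y z → (x -q y) -q z ≡ (x -q z) -q y
    swap = solve 3 (λ x y z → (x :- y) :- z := (x :- z) :- y) refl

module Solution (m : ℕ) where
  open Circulant (suc m)
  open Coefficients m using (n; N; b; b-interior; b-first; b-last)

  B G : Fin k → Q5
  B = bcoef n
  G d = (1q -q B d) *q invq N

  1-N*δ₀[suc-d]≡1 : ∀ (d : Fin K) → 1q -q N *q δ zero (suc d) ≡ 1q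
  1-N*δ₀[suc-d]≡1 d = begin
    1q -q N *q δ zero (suc d)   ≡⟨ cong (λ x → 1q -q N *q x) (δ-≢ {i = zero} {suc d} (λ ())) ⟩
    1q -q N *q 0q               ≡⟨ solve 1 (λ N → con 1q :- N :* con 0q := con 1q) refl N ⟩
    1q                          ∎
    where
    open ≡-Reasoning
    open Q5-Solver

  Δ-bcoef-suc : ∀ d → suc (toℕ d) < K ⊎ suc (toℕ d) ≡ K → Δ B (suc d) ≡ 1q -q N *q δ zero (suc d)
  Δ-bcoef : ∀ d → Δ B d ≡ 1q -q N *q δ zero d
  Δ-bcoef zero = begin
    (three *q b 0 -q b (toℕ (prev zero))) -q b (toℕ (next zero))
      ≡⟨ cong₂ (λ u v → (three *q b 0 -q b u) -q b v) toℕ-prev-zero (toℕ-next-< {zero} (s≤s z≤n)) ⟩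
    (three *q b 0 -q b K) -q b 1     ≡⟨ b-first ⟩
    1q -q N                          ≡⟨ cong (λ x → 1q -q x) (*q-identityʳ N) ⟨
    1q -q N *q 1q                    ≡⟨ cong (λ x → 1q -q N *q x) (δ-≡ {i = zero {k}} refl) ⟨
    1q -q N *q δ {k} zero zero       ∎
    where open ≡-Reasoning
  Δ-bcoef (suc d) = Δ-bcoef-suc d (ℕP.m≤n⇒m<n∨m≡n (FinP.toℕ<n d))

  Δ-bcoef-suc d (inj₁ 2+d≤K) = begin
    (three *q b (suc e) -q b (toℕ (prev (suc d)))) -q b (toℕ (next (suc d)))
      ≡⟨ cong₂ (λ u v → (three *q b (suc e) -q b u) -q b v)
               (toℕ-prev-suc {suc d} refl) (toℕ-next-< {suc d} 2+d≤K) ⟩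
    (three *q b (suc e) -q b e) -q b (suc (suc e))
      ≡⟨ b-interior e (ℕP.≤-pred (ℕP.≤-pred 2+d≤K)) ⟩
    1q
      ≡⟨ 1-N*δ₀[suc-d]≡1 d ⟨
    1q -q N *q δ zero (suc d) ∎
    where
    open ≡-Reasoning
    e = toℕ d
  Δ-bcoef-suc d (inj₂ 1+d≡K) = begin
    (three *q b (suc e) -q b (toℕ (prev (suc d)))) -q b (toℕ (next (suc d)))
      ≡⟨ cong₂ (λ u v → (three *q b u -q b (toℕ (prev (suc d)))) -q b (toℕ v))
               1+d≡K (next-last {suc d} 1+d≡K) ⟩
    (three *q b K -q b (toℕ (prev (suc d)))) -q b 0
      ≡⟨ cong (λ u → (three *q b K -q b u) -q b 0)
              (toℕ-prev-suc {suc d} (cong suc (ℕP.suc-injective 1+d≡K))) ⟩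
    (three *q b K -q b (suc m)) -q b 0
      ≡⟨ b-last ⟩
    1q
      ≡⟨ 1-N*δ₀[suc-d]≡1 d ⟨
    1q -q N *q δ zero (suc d) ∎
    where
    open ≡-Reasoning
    e = toℕ d

  Δ-G : ∀ d → Δ G d ≡ δ zero d
  Δ-G d = begin
    Δ G d                                        ≡⟨ linear (B d) (B (prev d)) (B (next d)) (invq N) ⟩
    (1q -q Δ B d) *q invq N                      ≡⟨ cong (λ x → (1q -q x) *q invq N) (Δ-bcoef d) ⟩
    (1q -q (1q -q N *q δ zero d)) *q invq N      ≡⟨ regroup N (invq N) (δ zero d) ⟩
    (N *q invq N) *q δ zero d                    ≡⟨ cong (_*q δ zero d) (*q-inverseʳ N (fromℕ-suc≢0q k)) ⟩
    1q *q δ zero d                               ≡⟨ *q-identityˡ (δ zero d) ⟩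
    δ zero d                                     ∎
    where
    open ≡-Reasoning
    open Q5-Solver
    linear : ∀ x y z w → (three *q ((1q -q x) *q w) -q (1q -q y) *q w) -q (1q -q z) *q w
                         ≡ (1q -q ((three *q x -q y) -q z)) *q w
    linear = solve 4 (λ x y z w →
      (con three :* ((con 1q :- x) :* w) :- (con 1q :- y) :* w) :- (con 1q :- z) :* w
        := (con 1q :- ((con three :* x :- y) :- z)) :* w) refl
    regroup : ∀ x y z → (1q -q (1q -q x *q z)) *q y ≡ (x *q y) *q z
    regroup = solve 3 (λ x y z → (con 1q :- (con 1q :- x :* z)) :* y := (x :* y) :* z) refl

  δ-offset : ∀ i j → δ zero (offset i j) ≡ δ i j
  δ-offset i j = δ-cong (λ 0≡offset → offset≡0⇒≡ (sym 0≡offset))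
                        (λ i≡j → sym (trans (cong (offset i) (sym i≡j)) (offset-self i)))

  M⊗circ-B≐R : (Mₘ n ⊗ circ k B) ≐ Rₘ n
  M⊗circ-B≐R i j =
    trans (M⊗circ B i j) (trans (Δ-bcoef (offset i j)) (cong (λ x → 1q -q N *q x) (δ-offset i j)))

  M⊗circ-G≐I : (Mₘ n ⊗ circ k G) ≐ Iₘ k
  M⊗circ-G≐I i j = trans (M⊗circ G i j) (trans (Δ-G (offset i j)) (δ-offset i j))

  circ-G⊗M≐I : (circ k G ⊗ Mₘ n) ≐ Iₘ k
  circ-G⊗M≐I i j = trans (circ⊗M G i j) (trans (Δ-G (offset i j)) (δ-offset i j))

  X⊗R≐circ-B : ∀ X → (X ⊗ Mₘ n) ≐ Iₘ k → (X ⊗ Rₘ n) ≐ circ k B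
  X⊗R≐circ-B X X⊗M≐I = left-inverse-solves X (Mₘ n) (circ k B) (Rₘ n) X⊗M≐I M⊗circ-B≐R

mainTheorem8 : (n : ℕ) → 4 ≤ n →
    -- C Cᵀ + I is invertible ...
    Σ (Mat (n ∸ 1)) (λ N → ((N ⊗ Mₘ n) ≐ Iₘ (n ∸ 1)) × ((Mₘ n ⊗ N) ≐ Iₘ (n ∸ 1)))
    -- ... and X = (C Cᵀ + I)⁻¹ (J − n I) equals circ(b₀,…,b_{n−2})
    × ((N : Mat (n ∸ 1)) → (N ⊗ Mₘ n) ≐ Iₘ (n ∸ 1) → (Mₘ n ⊗ N) ≐ Iₘ (n ∸ 1) →
        (N ⊗ Rₘ n) ≐ circ (n ∸ 1) (bcoef n))
mainTheorem8 (suc (suc (suc (suc m)))) (s≤s (s≤s (s≤s (s≤s z≤n)))) =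
  (circ _ G , circ-G⊗M≐I , M⊗circ-G≐I) ,
  λ X X⊗M≐I _ → X⊗R≐circ-B X X⊗M≐I
  where open Solution m
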